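{- Let $n, m\ge 1$ be integers, and let $1^{k_1} i_2^{k_2}\cdots i_r^{k_r}$ be a type with $r\ge 2$, $1<i_2<\cdots<i_r$, all $k_j\ge 1$, and $n=k_1+\sum_{j=2}^r k_j i_j$, satisfying \[ \left\lceil\frac{k_1}{k_2+\cdots+k_r}\right\rceil\ge (m-1)(i_r-1). \] Let $B$ be an $m$-AP-block of $\mathbb{Z}_n$ whose length is one of $1, i_2,\ldots,i_r$ (i.e. a block that can occur in an $m$-AP-partition of $\mathbb{Z}_n$ of this type). Then $B$ is not uniquely determined by its underlying set (that is, there exists an $m$-AP-block of $\mathbb{Z}_n$, different from $B$ as a sequence, with the same underlying set as $B$) if and only if $n=i_r m$ and $B$ has length $i_r$.
   Context: $\mathbb{Z}_n$ is the cyclic group of order $n$ with elements written $1,2,\ldots,n$, viewed as a directed cycle. An $m$-AP-block (arithmetic progression block of difference $m$) of length $i$ is a sequence $(x, x+m, x+2m,\ldots,x+(i-1)m) \pmod n$ of $i$ distinct elements of $\mathbb{Z}_n$; $x$ is its head, and its underlying set is the set of its entries. Two AP-blocks are different if they are different as sequences even if they have the same underlying set. An $m$-AP-partition of $\mathbb{Z}_n$ is a set of $m$-AP-blocks whose underlying sets form a partition of $\mathbb{Z}_n$; its type is $1^{k_1}i_2^{k_2}\cdots i_r^{k_r}$ if it has $k_1$ blocks of length $1$ and $k_j$ blocks of length $i_j$ for $2\le j\le r$ (zero exponents omitted). $\lceil x\rceil$ is the least integer $\ge x$. -}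

module Defs where

open import Data.Nat using (ℕ; zero; suc; _+_; _*_; _∸_; _<_; _≤_)
open import Data.Nat.DivMod using (_%_; _/_)
open import Data.Fin using (Fin; fromℕ)
open import Data.List using (List; map; upTo; allFin)
open import Data.Nat.ListAction using (sum)
open import Data.List.Relation.Unary.Unique.Propositional using (Unique)
open import Data.List.Membership.Propositional using (_∈_)
open import Data.Product using (Σ; _×_; ∃)
open import Relation.Binary.PropositionalEquality using (_≡_; _≢_)
open import Function.Bundles using (_⇔_)

-- Elements of ℤ_n are represented by the residues 0,…,n-1 (the element n of
-- the paper is the residue 0).  Reduction mod n (n ≥ 1 in all uses).
modN : ℕ → ℕ → ℕ
modN a zero    = a
modN a (suc n) = a % suc n

apSeq : (n m x i : ℕ) → List ℕ
apSeq n m x i = map (λ t → modN (x + t * m) n) (upTo i)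

IsAPBlock : (n m i : ℕ) → List ℕ → Set
IsAPBlock n m i s = Σ ℕ λ x → x < n × s ≡ apSeq n m x i × Unique s

SameSet : List ℕ → List ℕ → Set
SameSet s t = ∀ y → (y ∈ s) ⇔ (y ∈ t)

NotUniquelyDetermined : (n m : ℕ) → List ℕ → Set
NotUniquelyDetermined n m B =
  Σ (List ℕ) λ C → Σ ℕ λ j → IsAPBlock n m j C × C ≢ B × SameSet B C

-- ⌈ a / b ⌉ for b ≥ 1 (value at b = 0 is irrelevant).
ceilDiv : ℕ → ℕ → ℕ
ceilDiv a zero    = zero
ceilDiv a (suc b) = (a + b) / suc b

sumFin : (r : ℕ) → (Fin r → ℕ) → ℕ
sumFin r f = sum (map f (allFin r))

module Submission where

-- An m-AP-block B = (x, x+m, …, x+(i-1)m) of ℤ_n is "ambiguous" when some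
-- other m-AP-block C rearranges it (same set, different sequence).  The proof
-- has two independent halves.
--
-- Combinatorics of progressions (module Progressions): for any n ≥ 1 and m,
-- B is ambiguous iff i ≥ 2 and the progression closes up after i steps,
-- i.e. n ∣ i·m.  If it closes, reading B from its second entry gives B
-- rotated by one place.  Conversely, C starts at some entry x + a·m of B;
-- a = 0 would make C = B, and for 0 < a < i the entry of C following the
-- end of B must re-enter B, which forces n ∣ i·m.
--
-- Arithmetic of the type: the ceiling hypothesis yields m·(i_r - 1) < n,
-- and under this bound n ∣ i·m with 2 ≤ i ≤ i_r happens only when i = i_r
-- and n = i_r·m.

open import Defs
open import Data.Nat using (ℕ; suc; _+_; _*_; _∸_; _<_; _≤_; _≥_)
open import Data.Fin using (Fin; fromℕ; zero)
open import Data.List using (List)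
open import Data.Fin.Base using () renaming (_<_ to _<ᶠ_)
open import Data.Product using (Σ; _×_)
open import Data.Sum using (_⊎_)
open import Relation.Binary.PropositionalEquality using (_≡_)
open import Function.Bundles using (_⇔_)

open import Data.Nat using (zero; z≤n; s≤s; z<s; NonZero; >-nonZero)
open import Data.Nat.Properties
open import Data.Nat.DivMod using (_%_; _/_; m≡m%n+[m/n]*n; %-distribˡ-+; m%n%n≡m%n; %-remove-+ʳ; m%n<n; m/n*n≤m)
open import Data.Nat.Divisibility using (_∣_; divides; ∣m+n∣m⇒∣n; ∣-refl)
open import Data.Nat.Tactic.RingSolver using (solve-∀)
open import Data.Nat.ListAction using (sum)
open import Data.Fin using () renaming (suc to fsuc)
open import Data.Fin.Properties using (toℕ-injective; ≤fromℕ)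
open import Data.List using ([]; _∷_; _∷ʳ_; map; upTo; applyUpTo; allFin)
open import Data.List.Properties using (map-upTo; map-cong; applyUpTo-∷ʳ; ∷-injectiveˡ)
open import Data.List.Membership.Propositional using (_∈_)
open import Data.List.Membership.Propositional.Properties using (∈-applyUpTo⁺; ∈-applyUpTo⁻; ∈-allFin)
open import Data.List.Relation.Unary.Any using (here; there)
open import Data.List.Relation.Unary.All using (lookup; [])
open import Data.List.Relation.Unary.Unique.Propositional using (Unique; []; _∷_)
open import Data.List.Relation.Unary.Unique.Propositional.Properties using (++⁺)
open import Data.List.Relation.Binary.Permutation.Propositional using (↭-sym)
open import Data.List.Relation.Binary.Permutation.Propositional.Properties using (∈-resp-↭; ∷↭∷ʳ)
open import Data.Product using (_,_)
open import Data.Sum using (inj₁; inj₂)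
open import Data.Empty using (⊥-elim)
open import Relation.Nullary using (yes; no)
open import Data.Nat using (_<?_)
open import Relation.Binary.PropositionalEquality using (refl; sym; trans; cong; subst; subst₂; _≢_; module ≡-Reasoning)
open import Relation.Binary.Definitions using (tri<; tri≈; tri>)
open import Function.Bundles using (mk⇔; Equivalence)
open import Function.Construct.Composition using (_⇔-∘_)
open import Function using (_∘_)
open Equivalence using (to; from)

Rearrangement : List ℕ → List ℕ → Set
Rearrangement B C = Unique C × C ≢ B × SameSet B C

applyUpTo-injective : ∀ {A : Set} (f : ℕ → A) {i t u} →
  Unique (applyUpTo f i) → t < u → u < i → f t ≢ f u
applyUpTo-injective f {suc i} {zero} {suc u} (f₀∉ ∷ _) _ (s≤s u<i) =
  lookup f₀∉ (∈-applyUpTo⁺ (f ∘ suc) u<i)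
applyUpTo-injective f {suc i} {suc t} {suc u} (_ ∷ unique) (s≤s t<u) (s≤s u<i) =
  applyUpTo-injective (f ∘ suc) unique t<u u<i

sameSet⇒sameLength : ∀ (f : ℕ → ℕ) {i j} → Unique (applyUpTo f i) → Unique (applyUpTo f j) →
  SameSet (applyUpTo f i) (applyUpTo f j) → i ≡ j
sameSet⇒sameLength f {i} {j} uniqueᵢ uniqueⱼ same with <-cmp i j
... | tri≈ _ i≡j _ = i≡j
... | tri< i<j _ _ with ∈-applyUpTo⁻ f (from (same (f i)) (∈-applyUpTo⁺ f i<j))
...   | t , t<i , fᵢ≡fₜ = ⊥-elim (applyUpTo-injective f uniqueⱼ t<i i<j (sym fᵢ≡fₜ))
sameSet⇒sameLength f {i} {j} uniqueᵢ uniqueⱼ same | tri> _ _ j<i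
  with ∈-applyUpTo⁻ f (to (same (f j)) (∈-applyUpTo⁺ f j<i))
...   | t , t<j , fⱼ≡fₜ = ⊥-elim (applyUpTo-injective f uniqueᵢ t<j j<i (sym fⱼ≡fₜ))

applyUpTo-cong : ∀ {f h : ℕ → ℕ} → (∀ t → f t ≡ h t) → ∀ k → applyUpTo f k ≡ applyUpTo h k
applyUpTo-cong {f} {h} f≗h k = begin
  applyUpTo f k    ≡⟨ sym (map-upTo f k) ⟩
  map f (upTo k)   ≡⟨ map-cong f≗h (upTo k) ⟩
  map h (upTo k)   ≡⟨ map-upTo h k ⟩
  applyUpTo h k    ∎
  where open ≡-Reasoning

rotation-rearranges : ∀ x y ys → Unique (x ∷ y ∷ ys) → Rearrangement (x ∷ y ∷ ys) ((y ∷ ys) ∷ʳ x)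
rotation-rearranges x y ys (x∉ ∷ unique) = rotated-unique , differs , same-set
  where
  rotated-unique : Unique ((y ∷ ys) ∷ʳ x)
  rotated-unique = ++⁺ unique ([] ∷ []) λ where
    (v∈ , here refl) → lookup x∉ v∈ refl
    (_ , there ())
  differs : (y ∷ ys) ∷ʳ x ≢ x ∷ y ∷ ys
  differs eq = lookup x∉ (here refl) (sym (∷-injectiveˡ eq))
  same-set : SameSet (x ∷ y ∷ ys) ((y ∷ ys) ∷ʳ x)
  same-set _ = mk⇔ (∈-resp-↭ (∷↭∷ʳ x (y ∷ ys))) (∈-resp-↭ (↭-sym (∷↭∷ʳ x (y ∷ ys))))

%-absorbˡ : ∀ a b n .{{_ : NonZero n}} → (a % n + b) % n ≡ (a + b) % n
%-absorbˡ a b n = begin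
  (a % n + b) % n          ≡⟨ %-distribˡ-+ (a % n) b n ⟩
  (a % n % n + b % n) % n  ≡⟨ cong (λ r → (r + b % n) % n) (m%n%n≡m%n a n) ⟩
  (a % n + b % n) % n      ≡⟨ sym (%-distribˡ-+ a b n) ⟩
  (a + b) % n              ∎
  where open ≡-Reasoning

[a+b]%n≡a%n⇒n∣b : ∀ a b n .{{_ : NonZero n}} → (a + b) % n ≡ a % n → n ∣ b
[a+b]%n≡a%n⇒n∣b a b n eq = ∣m+n∣m⇒∣n (divides ((a + b) / n) quotients) (divides (a / n) refl)
  where
  open ≡-Reasoning
  quotients : (a / n) * n + b ≡ ((a + b) / n) * n
  quotients = +-cancelˡ-≡ (a % n) _ _ (begin
    a % n + ((a / n) * n + b)        ≡⟨ sym (+-assoc (a % n) _ b) ⟩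
    a % n + (a / n) * n + b          ≡⟨ cong (_+ b) (sym (m≡m%n+[m/n]*n a n)) ⟩
    a + b                            ≡⟨ m≡m%n+[m/n]*n (a + b) n ⟩
    (a + b) % n + ((a + b) / n) * n  ≡⟨ cong (_+ ((a + b) / n) * n) eq ⟩
    a % n + ((a + b) / n) * n        ∎)

module Progressions (n : ℕ) .{{_ : NonZero n}} (m : ℕ) where

  term : ℕ → ℕ → ℕ
  term x t = (x + t * m) % n

  block : ℕ → ℕ → List ℕ
  block x i = applyUpTo (term x) i

  progression-step : ∀ x a t → x + a * m + t * m ≡ x + (a + t) * m
  progression-step x a t = trans (+-assoc x (a * m) (t * m)) (cong (x +_) (sym (*-distribʳ-+ m a t)))

  term-restart : ∀ x a t → term (term x a) t ≡ term x (a + t)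
  term-restart x a t = trans (%-absorbˡ (x + a * m) (t * m) n) (cong (_% n) (progression-step x a t))

  block-normalise : ∀ y j → block (term y 0) j ≡ block y j
  block-normalise y j = applyUpTo-cong (term-restart y 0) j

  term-period : ∀ x d → n ∣ d * m → term x d ≡ term x 0
  term-period x d n∣dm = trans (%-remove-+ʳ x n∣dm) (cong (_% n) (sym (+-identityʳ x)))

  term-collision : ∀ x v d → term x (v + d) ≡ term x v → n ∣ d * m
  term-collision x v d eq =
    [a+b]%n≡a%n⇒n∣b (x + v * m) (d * m) n (trans (cong (_% n) (progression-step x v d)) eq)

  -- If the entry right after a duplicate-free block already lies in the
  -- block, it must be the first one, so the progression closes: n ∣ i·m.
  reentry⇒closed : ∀ x i → Unique (block x i) → term x i ∈ block x i → n ∣ i * m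
  reentry⇒closed x i unique reentry with ∈-applyUpTo⁻ (term x) reentry
  ... | zero , _ , xᵢ≡x₀ = term-collision x 0 i xᵢ≡x₀
  ... | suc t , t<i , xᵢ≡xₜ = ⊥-elim (applyUpTo-injective (term x) unique 0<gap gap<i
                                         (sym (term-period x gap n∣gap)))
    where
    gap = i ∸ suc t
    n∣gap : n ∣ gap * m
    n∣gap = term-collision x (suc t) gap (trans (cong (term x) (m+[n∸m]≡n (<⇒≤ t<i))) xᵢ≡xₜ)
    0<gap : 0 < gap
    0<gap = m<n⇒0<n∸m t<i
    gap<i : gap < i
    gap<i = ∸-monoʳ-< {i} {suc t} {0} z<s (<⇒≤ t<i)

  -- A block C with B's set starting at the a-th entry of B, 0 < a < i,
  -- contains x₀ = x_{a+b} with b < |C|; uniqueness in B forces a + b ≥ i, so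
  -- C contains x_i, which then re-enters B.
  shifted-head⇒closed : ∀ x i a j → Unique (block x i) → SameSet (block x i) (block (term x a) j) →
    0 < a → a < i → n ∣ i * m
  shifted-head⇒closed x i a j unique same 0<a a<i
    with ∈-applyUpTo⁻ (term (term x a)) (to (same (term x 0)) (∈-applyUpTo⁺ (term x) (<-trans 0<a a<i)))
  ... | b , b<j , x₀≡ with a + b <? i
  ...   | yes a+b<i = ⊥-elim (applyUpTo-injective (term x) unique (<-≤-trans 0<a (m≤m+n a b)) a+b<i
                                (trans x₀≡ (term-restart x a b)))
  ...   | no a+b≮i = reentry⇒closed x i unique
                       (from (same (term x i)) (subst (_∈ block (term x a) j) entry-i
                         (∈-applyUpTo⁺ (term (term x a)) i∸a<j)))
    where
    i∸a<j : i ∸ a < j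
    i∸a<j = ≤-<-trans (m≤n+o⇒m∸n≤o i a (≮⇒≥ a+b≮i)) b<j
    entry-i : term (term x a) (i ∸ a) ≡ term x i
    entry-i = trans (term-restart x a (i ∸ a)) (cong (term x) (m+[n∸m]≡n (<⇒≤ a<i)))

  -- A rearrangement of B by a block starting at B's a-th entry: a = 0 gives
  -- B itself (same set forces the same length), so 0 < a < i.
  rearranged-from⇒closed : ∀ x i a j → a < i → Unique (block x i) →
    Rearrangement (block x i) (block (term x a) j) → 2 ≤ i × n ∣ i * m
  rearranged-from⇒closed x i zero j _ unique (uniqueC , differs , same) = ⊥-elim (differs C≡B)
    where
    sameₓ : SameSet (block x i) (block x j)
    sameₓ = subst (SameSet (block x i)) (block-normalise x j) same
    i≡j : i ≡ j
    i≡j = sameSet⇒sameLength (term x) unique (subst Unique (block-normalise x j) uniqueC) sameₓ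
    C≡B : block (term x 0) j ≡ block x i
    C≡B = trans (block-normalise x j) (cong (block x) (sym i≡j))
  rearranged-from⇒closed x i (suc a) j a<i unique (_ , _ , same) =
    ≤-trans (s≤s (s≤s z≤n)) a<i , shifted-head⇒closed x i (suc a) j unique same z<s a<i

  rearranged⇒closed : ∀ x i y j → Unique (block x i) → Rearrangement (block x i) (block y j) →
    2 ≤ i × n ∣ i * m
  rearranged⇒closed x zero y zero _ (_ , differs , _) = ⊥-elim (differs refl)
  rearranged⇒closed x (suc i) y zero _ (_ , _ , same) with to (same (term x 0)) (here refl)
  ... | ()
  rearranged⇒closed x i y (suc j) unique rearrangement@(_ , _ , same)
    with ∈-applyUpTo⁻ (term x) (from (same (term y 0)) (here refl))
  ... | a , a<i , y₀≡xₐ = rearranged-from⇒closed x i a (suc j) a<i unique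
        (subst (Rearrangement (block x i)) C≡ rearrangement)
    where
    C≡ : block y (suc j) ≡ block (term x a) (suc j)
    C≡ = trans (sym (block-normalise y (suc j))) (cong (λ h → block h (suc j)) y₀≡xₐ)

  -- Backward direction: if n ∣ i·m with i ≥ 2, the block read from B's second
  -- entry is B rotated by one place, hence a rearrangement.
  closed⇒rotation : ∀ x i → 2 ≤ i → n ∣ i * m → Unique (block x i) →
    Rearrangement (block x i) (block (term x 1) i)
  closed⇒rotation x (suc (suc k)) (s≤s (s≤s z≤n)) n∣im unique =
    subst (Rearrangement (block x (suc (suc k)))) (sym rotated)
      (rotation-rearranges (term x 0) (term x 1) (applyUpTo (term x ∘ suc ∘ suc) k) unique)
    where
    open ≡-Reasoning
    rotated : block (term x 1) (suc (suc k)) ≡ applyUpTo (term x ∘ suc) (suc k) ∷ʳ term x 0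
    rotated = begin
      block (term x 1) (suc (suc k))
        ≡⟨ applyUpTo-cong (term-restart x 1) (suc (suc k)) ⟩
      applyUpTo (term x ∘ suc) (suc (suc k))
        ≡⟨ sym (applyUpTo-∷ʳ (term x ∘ suc) (suc k)) ⟩
      applyUpTo (term x ∘ suc) (suc k) ∷ʳ term x (suc (suc k))
        ≡⟨ cong (applyUpTo (term x ∘ suc) (suc k) ∷ʳ_) (term-period x (suc (suc k)) n∣im) ⟩
      applyUpTo (term x ∘ suc) (suc k) ∷ʳ term x 0
        ∎

apSeq≡block : ∀ n .{{_ : NonZero n}} m x i → apSeq n m x i ≡ Progressions.block n m x i
apSeq≡block (suc n) m x i = map-upTo _ i

notUnique⇔closed : ∀ n .{{_ : NonZero n}} m i B → IsAPBlock n m i B →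
  NotUniquelyDetermined n m B ⇔ (2 ≤ i × n ∣ i * m)
notUnique⇔closed n m i .(apSeq n m x i) (x , _ , refl , unique) = mk⇔ forward backward
  where
  open Progressions n m
  B≡ = apSeq≡block n m x i
  uniqueB : Unique (block x i)
  uniqueB = subst Unique B≡ unique
  forward : NotUniquelyDetermined n m (apSeq n m x i) → 2 ≤ i × n ∣ i * m
  forward (_ , j , (y , _ , refl , uniqueC) , differs , same) =
    rearranged⇒closed x i y j uniqueB (subst₂ Rearrangement B≡ (apSeq≡block n m y j) (uniqueC , differs , same))
  backward : 2 ≤ i × n ∣ i * m → NotUniquelyDetermined n m (apSeq n m x i)
  backward (2≤i , n∣im) =
    let (uniqueC , differs , same) = subst₂ Rearrangement (sym B≡) (sym (apSeq≡block n m (term x 1) i))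
                                       (closed⇒rotation x i 2≤i n∣im uniqueB)
    in apSeq n m (term x 1) i , i , (term x 1 , m%n<n _ n , refl , uniqueC) , differs , same

-- Anything below ⌈a/(b+1)⌉ is at most a + b, since ⌈a/(b+1)⌉·(b+1) ≤ a + b.
≤ceilDiv⇒≤ : ∀ c a b → c ≤ ceilDiv a (suc b) → c ≤ a + b
≤ceilDiv⇒≤ c a b c≤⌈a/b+1⌉ = begin
  c                          ≤⟨ m≤m*n c (suc b) ⟩
  c * suc b                  ≤⟨ *-monoˡ-≤ (suc b) c≤⌈a/b+1⌉ ⟩
  ((a + b) / suc b) * suc b  ≤⟨ m/n*n≤m (a + b) (suc b) ⟩
  a + b                      ∎
  where open ≤-Reasoning

ceiling⇒bound : ∀ n m k₁ K T r → n ≡ k₁ + (K + T) → 1 ≤ K → r ≤ T → 1 ≤ m →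
  (m ∸ 1) * r ≤ ceilDiv k₁ K → m * r < n
ceiling⇒bound n (suc m) k₁ (suc b) T r n≡ _ r≤T _ ceiling = begin-strict
  r + m * r           ≤⟨ +-mono-≤ r≤T (≤ceilDiv⇒≤ (m * r) k₁ b ceiling) ⟩
  T + (k₁ + b)        <⟨ n<1+n _ ⟩
  suc (T + (k₁ + b))  ≡⟨ regroup T k₁ b ⟩
  k₁ + (suc b + T)    ≡⟨ sym n≡ ⟩
  n                   ∎
  where
  open ≤-Reasoning
  regroup : ∀ T k₁ b → suc (T + (k₁ + b)) ≡ k₁ + (suc b + T)
  regroup = solve-∀

multiple<double⇒≡ : ∀ {n a} → n ∣ a → 0 < a → a < n + n → a ≡ n
multiple<double⇒≡ (divides zero a≡0) 0<a _ = ⊥-elim (<⇒≢ 0<a (sym a≡0))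
multiple<double⇒≡ {n} (divides (suc zero) a≡n) _ _ = trans a≡n (+-identityʳ n)
multiple<double⇒≡ {n} (divides (suc (suc q)) a≡) _ a<2n =
  ⊥-elim (<⇒≱ a<2n (subst (n + n ≤_) (sym a≡) (+-monoʳ-≤ n (m≤m+n n (q * n)))))

closed⇔full : ∀ {n m i R} → 1 ≤ m → 2 ≤ R → i ≤ R → m * (R ∸ 1) < n →
  (2 ≤ i × n ∣ i * m) ⇔ (n ≡ R * m × i ≡ R)
closed⇔full {n} {m} {i} {suc r} 1≤m 2≤R@(s≤s 1≤r) i≤R bound = mk⇔ forward backward
  where
  open ≤-Reasoning
  backward : n ≡ suc r * m × i ≡ suc r → 2 ≤ i × n ∣ i * m
  backward (n≡Rm , refl) = 2≤R , subst (n ∣_) n≡Rm ∣-refl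
  m<n : m < n
  m<n = ≤-<-trans (≤-trans (≤-reflexive (sym (*-identityʳ m))) (*-monoʳ-≤ m 1≤r)) bound
  forward : 2 ≤ i × n ∣ i * m → n ≡ suc r * m × i ≡ suc r
  forward (2≤i , n∣im) = trans (sym im≡n) (cong (_* m) i≡R) , i≡R
    where
    im<2n : i * m < n + n
    im<2n = begin-strict
      i * m      ≤⟨ *-monoˡ-≤ m i≤R ⟩
      m + r * m  ≡⟨ cong (m +_) (*-comm r m) ⟩
      m + m * r  <⟨ +-mono-< m<n bound ⟩
      n + n      ∎
    im≡n : i * m ≡ n
    im≡n = multiple<double⇒≡ n∣im (*-mono-≤ (≤-trans (s≤s z≤n) 2≤i) 1≤m) im<2n
    r<i : r < i
    r<i = *-cancelˡ-< m r i (<-≤-trans bound (≤-reflexive (trans (sym im≡n) (*-comm i m))))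
    i≡R : i ≡ suc r
    i≡R = ≤-antisym i≤R r<i

*-split : ∀ k p → 1 ≤ p → k * p ≡ k + k * (p ∸ 1)
*-split k (suc p) _ = *-suc k p

sum-map-+ : ∀ {A : Set} (f g : A → ℕ) xs →
  sum (map (λ a → f a + g a) xs) ≡ sum (map f xs) + sum (map g xs)
sum-map-+ f g [] = refl
sum-map-+ f g (a ∷ xs) = trans (cong (f a + g a +_) (sum-map-+ f g xs)) (interchange (f a) (g a) _ _)
  where
  interchange : ∀ p q P Q → p + q + (P + Q) ≡ p + P + (q + Q)
  interchange = solve-∀

∈⇒≤sum-map : ∀ {A : Set} (f : A → ℕ) {a xs} → a ∈ xs → f a ≤ sum (map f xs)
∈⇒≤sum-map f {xs = _ ∷ _} (here refl) = m≤m+n _ _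
∈⇒≤sum-map f {xs = y ∷ _} (there a∈) = ≤-trans (∈⇒≤sum-map f a∈) (m≤n+m _ (f y))

summand≤sumFin : ∀ r (f : Fin r → ℕ) j → f j ≤ sumFin r f
summand≤sumFin r f j = ∈⇒≤sum-map f (∈-allFin j)

-- Facts about the parts 1 < i₂ < ⋯ < i_r of a type (is j = i_{j+2}).
module TypeParts (s : ℕ) (is : Fin (suc s) → ℕ) (1<is₀ : 1 < is zero)
                 (increasing : ∀ a b → a <ᶠ b → is a < is b) where

  largest : ℕ
  largest = is (fromℕ s)

  is₀≤ : ∀ j → is zero ≤ is j
  is₀≤ zero = ≤-refl
  is₀≤ (fsuc j) = <⇒≤ (increasing zero (fsuc j) z<s)

  1≤is : ∀ j → 1 ≤ is j
  1≤is j = ≤-trans (<⇒≤ 1<is₀) (is₀≤ j)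

  ≤largest : ∀ j → is j ≤ largest
  ≤largest j with m≤n⇒m<n∨m≡n (≤fromℕ j)
  ... | inj₁ j<r = <⇒≤ (increasing j (fromℕ s) j<r)
  ... | inj₂ j≡r = ≤-reflexive (cong is (toℕ-injective j≡r))

  2≤largest : 2 ≤ largest
  2≤largest = ≤-trans 1<is₀ (is₀≤ (fromℕ s))

  admissible≤largest : ∀ i → (i ≡ 1 ⊎ Σ (Fin (suc s)) (λ j → i ≡ is j)) → i ≤ largest
  admissible≤largest .1 (inj₁ refl) = <⇒≤ 2≤largest
  admissible≤largest .(is j) (inj₂ (j , refl)) = ≤largest j

-- The type 1^{k1} i_2^{k_2} ⋯ i_r^{k_r} with r = s + 2: is j = i_{j+2}, ks j = k_{j+2}.
-- Writing n = k₁ + (K + T) with K = Σ k_j and T = Σ k_j (i_j - 1) ≥ i_r - 1,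
-- the ceiling hypothesis gives m·(i_r - 1) < n; compose the characterisation
-- of ambiguous blocks with the arithmetic equivalence.
proposition1 : (n m k1 s : ℕ) (is ks : Fin (suc s) → ℕ) →
    n ≥ 1 → m ≥ 1 → k1 ≥ 1 →
    (∀ j → ks j ≥ 1) →
    1 < is zero →
    (∀ a b → a <ᶠ b → is a < is b) →
    n ≡ k1 + sumFin (suc s) (λ j → ks j * is j) →
    ceilDiv k1 (sumFin (suc s) ks) ≥ (m ∸ 1) * (is (fromℕ s) ∸ 1) →
    (i : ℕ) → (i ≡ 1 ⊎ Σ (Fin (suc s)) (λ j → i ≡ is j)) →
    (B : List ℕ) → IsAPBlock n m i B →
    NotUniquelyDetermined n m B ⇔ (n ≡ is (fromℕ s) * m × i ≡ is (fromℕ s))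
proposition1 n m k1 s is ks n≥1 m≥1 _ ks≥1 1<is₀ increasing n≡ ceiling i admissible B isBlock =
  closed⇔full m≥1 2≤largest (admissible≤largest i admissible) bound
    ⇔-∘ notUnique⇔closed n m i B isBlock
  where
  open TypeParts s is 1<is₀ increasing
  instance
    n≢0 : NonZero n
    n≢0 = >-nonZero n≥1
  K T : ℕ
  K = sumFin (suc s) ks
  T = sumFin (suc s) (λ j → ks j * (is j ∸ 1))
  n≡k1+K+T : n ≡ k1 + (K + T)
  n≡k1+K+T = trans n≡ (cong (k1 +_) (trans (cong sum (map-cong split (allFin (suc s))))
                                                (sum-map-+ ks (λ j → ks j * (is j ∸ 1)) (allFin (suc s)))))
    where
    split : ∀ j → ks j * is j ≡ ks j + ks j * (is j ∸ 1)
    split j = *-split (ks j) (is j) (1≤is j)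
  bound : m * (largest ∸ 1) < n
  bound = ceiling⇒bound n m k1 K T (largest ∸ 1) n≡k1+K+T (≤-trans (ks≥1 zero) (summand≤sumFin _ ks zero))
            (≤-trans (≤-trans (≤-reflexive (sym (*-identityˡ _))) (*-monoˡ-≤ (largest ∸ 1) (ks≥1 (fromℕ s))))
                     (summand≤sumFin _ (λ j → ks j * (is j ∸ 1)) (fromℕ s)))
            m≥1 ceiling
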